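{- For every $k\ge 2$, $\sigma(kC_4)=2$. Moreover, there is a sum labelling $\lambda$ of $kC_4+N_2$ whose label set contains a non-trivial arithmetic progression.
   Context: A graph $H=(V,E)$ is a sum graph if there is an injective map $\lambda:V\to\mathbb{N}$ (a sum labelling) such that $E=\{xy : \exists z\in V,\ \lambda(z)=\lambda(x)+\lambda(y)\}$. For a graph $G$ without isolated vertices, $\sigma(G)$ is the minimum $k$ such that $G+N_k$ is a sum graph ($N_k$: $k$ isolated vertices, $+$: disjoint union). $kC_4$ is the disjoint union of $k$ copies of the 4-cycle. A labelling $\lambda$ of $V$ contains a non-trivial arithmetic progression (NTAP) if there are positive integers $x,d$ with $x,\ x+d,\ x+2d\in\lambda(V)$ and $d\notin\lambda(V)$. -}

module Defs where

open import Level using (0ℓ)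
open import Data.Nat using (ℕ; _+_; _*_; _%_; _<_)
open import Data.Fin using (Fin; toℕ)
open import Data.Product using (Σ; _×_; ∃)
open import Data.Sum using (_⊎_; inj₁; inj₂)
open import Data.Empty using (⊥)
open import Relation.Nullary using (¬_)
open import Relation.Binary.PropositionalEquality using (_≡_; _≢_)

record Graph : Set₁ where
  field
    V   : Set
    Adj : V → V → Set
open Graph public

_+N_ : Graph → ℕ → Graph
G +N m = record { V = V G ⊎ Fin m ; Adj = adj }
  where
    adj : V G ⊎ Fin m → V G ⊎ Fin m → Set
    adj (inj₁ x) (inj₁ y) = Adj G x y
    adj _ _ = ⊥

-- kC_4: k disjoint 4-cycles; vertex (i , a) is vertex a (mod 4) of the i-th cycle.
kC4 : ℕ → Graph
kC4 k = record { V = Fin k × Fin 4 ; Adj = adj }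
  where
    adj : Fin k × Fin 4 → Fin k × Fin 4 → Set
    adj (i Data.Product., a) (j Data.Product., b) =
      i ≡ j × (toℕ b ≡ (toℕ a + 1) % 4 ⊎ toℕ a ≡ (toℕ b + 1) % 4)

_∈Labels_ : {V : Set} → ℕ → (V → ℕ) → Set
n ∈Labels λ′ = ∃ λ v → λ′ v ≡ n

record SumLabelling (H : Graph) : Set where
  field
    label     : V H → ℕ
    injective : ∀ x y → label x ≡ label y → x ≡ y
    positive  : ∀ x → 0 < label x
    sum-adj   : ∀ x y → x ≢ y → Adj H x y → (label x + label y) ∈Labels label
    adj-sum   : ∀ x y → x ≢ y → (label x + label y) ∈Labels label → Adj H x y
open SumLabelling public

IsSumGraph : Graph → Set
IsSumGraph H = SumLabelling H

σ-is : Graph → ℕ → Set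
σ-is G s = IsSumGraph (G +N s) × (∀ j → j < s → ¬ IsSumGraph (G +N j))

HasNTAP : {V : Set} → (V → ℕ) → Set
HasNTAP λ′ = Σ ℕ λ x → Σ ℕ λ d →
  0 < x × 0 < d × x ∈Labels λ′ × (x + d) ∈Labels λ′ × (x + 2 * d) ∈Labels λ′
  × ¬ (d ∈Labels λ′)

-- Lower bound: in a sum labelling of kC₄ + N₁ a vertex w of largest label on the cycles has
-- two distinct neighbours b, c; the labels λw + λb and λw + λc exceed every cycle label, so
-- both belong to the single isolated vertex, forcing λb = λc.
--
-- Upper bound (k = m + 2): every label is r + 81 c with a residue r ≤ 40 that depends only on
-- the position of the vertex and on whether it lies on cycle 0, on cycles 1 … m + 1, or is
-- isolated. At positions 0, 1, 2, 3 of cycle j + 1 the residues are 1, 7, 3, 18 and the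
-- coefficients j, m − j, j, 2m − j, so each edge sum has a coefficient independent of j;
-- cycle 0 carries exactly these four edge sums, and its own edge sums are the two isolated
-- labels and the label at position 3 of cycle 1. As 81 > 2 · 40, a sum of two labels is read
-- off digitwise: a finite check on residues leaves only consecutive positions of one cycle,
-- and then the coefficients force the same cycle. The progression is
-- 18 + 162m, 29 + 243m, 40 + 324m with difference 11 + 81m, and 11 is no residue.

module Submission where

open import Defs
open import Data.Nat using (ℕ; _≤_)
open import Data.Product using (Σ; _×_)

open import Data.Nat using (zero; suc; _+_; _*_; _∸_; _<_; _%_; z≤n; s≤s; NonZero)
open import Data.Nat.Properties
open import Data.Nat.DivMod using ([m+kn]%n≡m%n; m<n⇒m%n≡m)
open import Data.Nat.Tactic.RingSolver using (solve-∀)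
open import Algebra.Properties.CommutativeSemigroup +-commutativeSemigroup using (x∙yz≈y∙xz)
open import Data.Fin using (Fin; zero; suc; toℕ; #_)
import Data.Fin.Properties as Fin
open import Data.Fin.Properties using (toℕ-injective; toℕ≤pred[n]; all?)
open import Data.Vec using (_∷_; []; lookup)
open import Data.List using (List; cartesianProduct; allFin)
open import Data.List.Membership.Propositional using (_∈_)
open import Data.List.Membership.Propositional.Properties using (∈-cartesianProduct⁺; ∈-allFin)
import Data.List.Relation.Unary.All as All
open import Data.List.Extrema.Nat using (argmax; f[xs]≤f[argmax])
open import Data.Product using (_,_; proj₁; proj₂)
open import Data.Sum using (_⊎_; inj₁; inj₂)
open import Data.Sum.Properties using (inj₁-injective)
open import Data.Empty using (⊥-elim)
open import Function using (_∘_)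
open import Relation.Nullary using (¬_; Dec; no)
open import Relation.Nullary.Decidable using (toWitness; map′; _×-dec_; _⊎-dec_; _→-dec_; ¬?)
open import Relation.Unary using (Decidable)
open import Relation.Binary using (DecidableEquality)
open import Relation.Binary.PropositionalEquality

r+c*n-injective : ∀ {n r r′ c c′} .{{_ : NonZero n}} → r < n → r′ < n →
                  r + c * n ≡ r′ + c′ * n → r ≡ r′ × c ≡ c′
r+c*n-injective {n} {r} {r′} {c} {c′} r<n r′<n eq = r≡r′ , c≡c′
  where
  open ≡-Reasoning
  r≡r′ : r ≡ r′
  r≡r′ = begin
    r                 ≡⟨ m<n⇒m%n≡m r<n ⟨
    r % n             ≡⟨ [m+kn]%n≡m%n r c n ⟨
    (r + c * n) % n   ≡⟨ cong (_% n) eq ⟩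
    (r′ + c′ * n) % n ≡⟨ [m+kn]%n≡m%n r′ c′ n ⟩
    r′ % n            ≡⟨ m<n⇒m%n≡m r′<n ⟩
    r′                ∎
  c≡c′ : c ≡ c′
  c≡c′ = *-cancelʳ-≡ c c′ n (+-cancelˡ-≡ r _ _ (trans eq (cong (_+ c′ * n) (sym r≡r′))))

Fin<2-irrelevant : ∀ {n} → n < 2 → (i j : Fin n) → i ≡ j
Fin<2-irrelevant (s≤s z≤n)       ()   _
Fin<2-irrelevant (s≤s (s≤s z≤n)) zero zero = refl

HasTwoNeighbours : (G : Graph) → V G → Set
HasTwoNeighbours G v = Σ (V G) λ b → Σ (V G) λ c →
  b ≢ c × v ≢ b × v ≢ c × Adj G v b × Adj G v c

module _ (G : Graph) (vertices : List (V G)) (complete : ∀ v → v ∈ vertices) (v₀ : V G)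
         (two-neighbours : ∀ v → HasTwoNeighbours G v) where

  module _ {n} (L : SumLabelling (G +N n)) where
    f : V G → ℕ
    f v = label L (inj₁ v)

    w : V G
    w = argmax f v₀ vertices

    f≤f[w] : ∀ v → f v ≤ f w
    f≤f[w] v = All.lookup (f[xs]≤f[argmax] v₀ vertices) (complete v)

    isolated-sum : ∀ b → w ≢ b → Adj G w b → Σ (Fin n) λ i → label L (inj₂ i) ≡ f w + f b
    isolated-sum b w≢b wb with sum-adj L (inj₁ w) (inj₁ b) (w≢b ∘ inj₁-injective) wb
    ... | inj₂ i , e = i , e
    ... | inj₁ v , e = ⊥-elim (<-irrefl e (≤-<-trans (f≤f[w] v) (m<m+n (f w) (positive L (inj₁ b)))))

  ¬SumLabelling-+N<2 : ∀ {n} → n < 2 → ¬ SumLabelling (G +N n)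
  ¬SumLabelling-+N<2 n<2 L with two-neighbours (w L)
  ... | b , c , b≢c , w≢b , w≢c , wb , wc
    with isolated-sum L b w≢b wb | isolated-sum L c w≢c wc
  ... | i , fw+fb | i′ , fw+fc =
    b≢c (inj₁-injective (injective L (inj₁ b) (inj₁ c) (+-cancelˡ-≡ (f L (w L)) _ _ same-sum)))
    where
    same-sum : f L (w L) + f L b ≡ f L (w L) + f L c
    same-sum = trans (sym fw+fb) (trans (cong (label L ∘ inj₂) (Fin<2-irrelevant n<2 i i′)) fw+fc)

kC4-two-neighbours : ∀ k v → HasTwoNeighbours (kC4 k) v
kC4-two-neighbours k (i , zero) =
  (i , # 1) , (i , # 3) , (λ ()) , (λ ()) , (λ ()) , (refl , inj₁ refl) , (refl , inj₂ refl)
kC4-two-neighbours k (i , suc zero) =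
  (i , # 2) , (i , # 0) , (λ ()) , (λ ()) , (λ ()) , (refl , inj₁ refl) , (refl , inj₂ refl)
kC4-two-neighbours k (i , suc (suc zero)) =
  (i , # 3) , (i , # 1) , (λ ()) , (λ ()) , (λ ()) , (refl , inj₁ refl) , (refl , inj₂ refl)
kC4-two-neighbours k (i , suc (suc (suc zero))) =
  (i , # 0) , (i , # 2) , (λ ()) , (λ ()) , (λ ()) , (refl , inj₁ refl) , (refl , inj₂ refl)

Consecutive : Fin 4 → Fin 4 → Set
Consecutive a b = toℕ b ≡ (toℕ a + 1) % 4 ⊎ toℕ a ≡ (toℕ b + 1) % 4

consecutive? : ∀ a b → Dec (Consecutive a b)
consecutive? a b = toℕ b ≟ (toℕ a + 1) % 4 ⊎-dec toℕ a ≟ (toℕ b + 1) % 4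

next : Fin 4 → Fin 4
next = lookup (# 1 ∷ # 2 ∷ # 3 ∷ # 0 ∷ [])

consecutive-next : ∀ a → toℕ (next a) ≡ (toℕ a + 1) % 4
consecutive-next = toWitness {a? = all? λ a → toℕ (next a) ≟ (toℕ a + 1) % 4} _

consecutive⇒next : ∀ a b → Consecutive a b → b ≡ next a ⊎ a ≡ next b
consecutive⇒next = toWitness {a? = all? λ a → all? λ b →
  consecutive? a b →-dec (b Fin.≟ next a ⊎-dec a Fin.≟ next b)} _

data Shape : Set where
  ordinary special : Fin 4 → Shape
  isolated         : Fin 2 → Shape

_≟ˢ_ : DecidableEquality Shape
ordinary a ≟ˢ ordinary b = map′ (cong ordinary) (λ { refl → refl }) (a Fin.≟ b)
special a  ≟ˢ special b  = map′ (cong special) (λ { refl → refl }) (a Fin.≟ b)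
isolated i ≟ˢ isolated j = map′ (cong isolated) (λ { refl → refl }) (i Fin.≟ j)
ordinary _ ≟ˢ special _  = no λ ()
ordinary _ ≟ˢ isolated _ = no λ ()
special _  ≟ˢ ordinary _ = no λ ()
special _  ≟ˢ isolated _ = no λ ()
isolated _ ≟ˢ ordinary _ = no λ ()
isolated _ ≟ˢ special _  = no λ ()

∀-shape? : {P : Shape → Set} → Decidable P → Dec (∀ s → P s)
∀-shape? P? = map′
  (λ (o , s , i) → λ { (ordinary a) → o a ; (special a) → s a ; (isolated j) → i j })
  (λ ∀P → ∀P ∘ ordinary , ∀P ∘ special , ∀P ∘ isolated)
  (all? (P? ∘ ordinary) ×-dec all? (P? ∘ special) ×-dec all? (P? ∘ isolated))

residue : Shape → ℕ
residue (ordinary a) = lookup (1 ∷ 7 ∷ 3 ∷ 18 ∷ []) a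
residue (special a)  = lookup (8 ∷ 21 ∷ 19 ∷ 10 ∷ []) a
residue (isolated i) = lookup (29 ∷ 40 ∷ []) i

-- The position on cycle 0 whose label is the sum over the ordinary edge from a to next a.
sumPosition : Fin 4 → Fin 4
sumPosition = lookup (# 0 ∷ # 3 ∷ # 1 ∷ # 2 ∷ [])

data AdmissibleSum : Shape → Shape → Shape → Set where
  special  : ∀ {a b u} → Consecutive a b → AdmissibleSum (special a) (special b) u
  forward  : ∀ {a b c} → b ≡ next a → c ≡ sumPosition a →
             AdmissibleSum (ordinary a) (ordinary b) (special c)
  backward : ∀ {a b c} → a ≡ next b → c ≡ sumPosition b →
             AdmissibleSum (ordinary a) (ordinary b) (special c)

admissibleSum? : ∀ s t u → Dec (AdmissibleSum s t u)
admissibleSum? (special a) (special b) u = map′ special (λ { (special ab) → ab }) (consecutive? a b)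
admissibleSum? (ordinary a) (ordinary b) (special c) = map′
  (λ { (inj₁ (p , q)) → forward p q ; (inj₂ (p , q)) → backward p q })
  (λ { (forward p q) → inj₁ (p , q) ; (backward p q) → inj₂ (p , q) })
  ((b Fin.≟ next a ×-dec c Fin.≟ sumPosition a) ⊎-dec (a Fin.≟ next b ×-dec c Fin.≟ sumPosition b))
admissibleSum? (ordinary _) (ordinary _) (ordinary _) = no λ ()
admissibleSum? (ordinary _) (ordinary _) (isolated _) = no λ ()
admissibleSum? (ordinary _) (special _)  _ = no λ ()
admissibleSum? (ordinary _) (isolated _) _ = no λ ()
admissibleSum? (special _)  (ordinary _) _ = no λ ()
admissibleSum? (special _)  (isolated _) _ = no λ ()
admissibleSum? (isolated _) _            _ = no λ ()

residue-admissibleSum : ∀ s t u → residue s + residue t ≡ residue u → AdmissibleSum s t u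
residue-admissibleSum = toWitness {a? = ∀-shape? λ s → ∀-shape? λ t → ∀-shape? λ u →
  residue s + residue t ≟ residue u →-dec admissibleSum? s t u} _

residue-injective : ∀ s t → residue s ≡ residue t → s ≡ t
residue-injective = toWitness {a? = ∀-shape? λ s → ∀-shape? λ t →
  residue s ≟ residue t →-dec s ≟ˢ t} _

residue-bounds : ∀ s → 0 < residue s × residue s ≤ 40
residue-bounds = toWitness {a? = ∀-shape? λ s → 0 <? residue s ×-dec residue s ≤? 40} _

residue≢11 : ∀ s → residue s ≢ 11
residue≢11 = toWitness {a? = ∀-shape? λ s → ¬? (residue s ≟ 11)} _

ordinary-edge-residue : ∀ a →
  residue (ordinary a) + residue (ordinary (next a)) ≡ residue (special (sumPosition a))
ordinary-edge-residue = toWitness {a? = all? λ a →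
  residue (ordinary a) + residue (ordinary (next a)) ≟ residue (special (sumPosition a))} _

encode : ℕ → ℕ → ℕ
encode r c = r + c * 81

encode-+ : ∀ r c r′ c′ → encode r c + encode r′ c′ ≡ encode (r + r′) (c + c′)
encode-+ = identity
  where
  identity : ∀ r c r′ c′ → (r + c * 81) + (r′ + c′ * 81) ≡ (r + r′) + (c + c′) * 81
  identity = solve-∀

residue<81 : ∀ s → residue s < 81
residue<81 s = s≤s (≤-trans (proj₂ (residue-bounds s)) (m≤m+n 40 40))

residue+residue<81 : ∀ s t → residue s + residue t < 81
residue+residue<81 s t = s≤s (+-mono-≤ (proj₂ (residue-bounds s)) (proj₂ (residue-bounds t)))

module Construction (m : ℕ) where

  H : Graph
  H = kC4 (suc (suc m)) +N 2

  shape : V H → Shape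
  shape (inj₁ (zero  , a)) = special a
  shape (inj₁ (suc _ , a)) = ordinary a
  shape (inj₂ i)           = isolated i

  ordinaryCoeff : Fin 4 → ℕ → ℕ
  ordinaryCoeff a j = lookup (j ∷ m ∸ j ∷ j ∷ m + (m ∸ j) ∷ []) a

  specialCoeff : Fin 4 → ℕ
  specialCoeff = lookup (m ∷ m + m ∷ m + m ∷ m ∷ [])

  coeff : V H → ℕ
  coeff (inj₁ (zero  , a)) = specialCoeff a
  coeff (inj₁ (suc j , a)) = ordinaryCoeff a (toℕ j)
  coeff (inj₂ i)           = lookup (m + (m + m) ∷ (m + m) + (m + m) ∷ []) i

  labelOf : V H → ℕ
  labelOf x = encode (residue (shape x)) (coeff x)

  ordinaryCoeff-injective : ∀ a {i j} → i ≤ m → j ≤ m → ordinaryCoeff a i ≡ ordinaryCoeff a j → i ≡ j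
  ordinaryCoeff-injective zero                   _   _   e = e
  ordinaryCoeff-injective (suc zero)             i≤m j≤m e = ∸-cancelˡ-≡ i≤m j≤m e
  ordinaryCoeff-injective (suc (suc zero))       _   _   e = e
  ordinaryCoeff-injective (suc (suc (suc zero))) i≤m j≤m e = ∸-cancelˡ-≡ i≤m j≤m (+-cancelˡ-≡ m _ _ e)

  ordinary-edge-coeff : ∀ a {j} → j ≤ m →
    ordinaryCoeff a j + ordinaryCoeff (next a) j ≡ specialCoeff (sumPosition a)
  ordinary-edge-coeff zero                   j≤m = m+[n∸m]≡n j≤m
  ordinary-edge-coeff (suc zero)             j≤m = m∸n+n≡m j≤m
  ordinary-edge-coeff (suc (suc zero)) {j}   j≤m = trans (x∙yz≈y∙xz j m _) (cong (m +_) (m+[n∸m]≡n j≤m))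
  ordinary-edge-coeff (suc (suc (suc zero))) j≤m = trans (+-assoc m _ _) (cong (m +_) (m∸n+n≡m j≤m))

  -- The sum over an ordinary edge does not depend on the cycle, so it pins the cycle down.
  same-cycle : ∀ a (i j : Fin (suc m)) →
    ordinaryCoeff a (toℕ i) + ordinaryCoeff (next a) (toℕ j) ≡ specialCoeff (sumPosition a) → i ≡ j
  same-cycle a i j e = toℕ-injective (ordinaryCoeff-injective a (toℕ≤pred[n] i) (toℕ≤pred[n] j)
    (+-cancelʳ-≡ (ordinaryCoeff (next a) (toℕ j)) _ _ (trans e (sym (ordinary-edge-coeff a (toℕ≤pred[n] j))))))

  decode : ∀ {x r c} → labelOf x ≡ encode r c → r < 81 → residue (shape x) ≡ r × coeff x ≡ c
  decode {x} e r<81 = r+c*n-injective (residue<81 (shape x)) r<81 e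

  is-sum : ∀ x y z → residue (shape x) + residue (shape y) ≡ residue (shape z) →
           coeff x + coeff y ≡ coeff z → (labelOf x + labelOf y) ∈Labels labelOf
  is-sum x y z r c = z , sym (trans (encode-+ (residue (shape x)) (coeff x) (residue (shape y)) (coeff y))
                                    (cong₂ encode r c))

  edge-sum : ∀ i a → (labelOf (inj₁ (i , a)) + labelOf (inj₁ (i , next a))) ∈Labels labelOf
  edge-sum i@zero a@zero =
    is-sum (inj₁ (i , a)) (inj₁ (i , next a)) (inj₂ zero) refl refl
  edge-sum i@zero a@(suc zero) =
    is-sum (inj₁ (i , a)) (inj₁ (i , next a)) (inj₂ (suc zero)) refl refl
  edge-sum i@zero a@(suc (suc zero)) =
    is-sum (inj₁ (i , a)) (inj₁ (i , next a)) (inj₂ zero) refl (+-comm (m + m) m)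
  edge-sum i@zero a@(suc (suc (suc zero))) =
    is-sum (inj₁ (i , a)) (inj₁ (i , next a)) (inj₁ (suc zero , # 3)) refl refl
  edge-sum i@(suc j) a =
    is-sum (inj₁ (i , a)) (inj₁ (i , next a)) (inj₁ (zero , sumPosition a))
      (ordinary-edge-residue a) (ordinary-edge-coeff a (toℕ≤pred[n] j))

  adjacent⇒sum : ∀ x y → Adj H x y → (labelOf x + labelOf y) ∈Labels labelOf
  adjacent⇒sum (inj₁ (i , a)) (inj₁ (_ , b)) (refl , ab) with consecutive⇒next a b ab
  ... | inj₁ refl = edge-sum i a
  ... | inj₂ refl = subst (_∈Labels labelOf) (+-comm (labelOf (inj₁ (i , b))) _) (edge-sum i b)
  adjacent⇒sum (inj₁ _) (inj₂ _) ()
  adjacent⇒sum (inj₂ _) _        ()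

  admissible⇒adjacent : ∀ x y z → AdmissibleSum (shape x) (shape y) (shape z) →
                        coeff x + coeff y ≡ coeff z → Adj H x y
  admissible⇒adjacent (inj₁ (zero , _)) (inj₁ (zero , _)) _ (special ab) _ = refl , ab
  admissible⇒adjacent (inj₁ (suc i , a)) (inj₁ (suc j , _)) (inj₁ (zero , _)) (forward refl refl) e =
    cong suc (same-cycle a i j e) , inj₁ (consecutive-next a)
  admissible⇒adjacent (inj₁ (suc i , _)) (inj₁ (suc j , b)) (inj₁ (zero , _)) (backward refl refl) e =
    cong suc (sym (same-cycle b j i (trans (+-comm (ordinaryCoeff b (toℕ j)) _) e))) , inj₂ (consecutive-next b)

  sum⇒adjacent : ∀ x y → (labelOf x + labelOf y) ∈Labels labelOf → Adj H x y
  sum⇒adjacent x y (z , e) = admissible⇒adjacent x y z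
    (residue-admissibleSum _ _ _ (sym (proj₁ decoded))) (sym (proj₂ decoded))
    where
    decoded = decode {z} (trans e (encode-+ (residue (shape x)) (coeff x) (residue (shape y)) (coeff y)))
                         (residue+residue<81 (shape x) (shape y))

  shape-coeff-injective : ∀ x y → shape x ≡ shape y → coeff x ≡ coeff y → x ≡ y
  shape-coeff-injective (inj₁ (zero , _)) (inj₁ (zero , _)) refl _ = refl
  shape-coeff-injective (inj₁ (suc i , a)) (inj₁ (suc j , _)) refl e =
    cong (λ k → inj₁ (suc k , a)) (toℕ-injective (ordinaryCoeff-injective a (toℕ≤pred[n] i) (toℕ≤pred[n] j) e))
  shape-coeff-injective (inj₂ _) (inj₂ _) refl _ = refl
  shape-coeff-injective (inj₂ _) (inj₁ (zero , _)) () _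
  shape-coeff-injective (inj₂ _) (inj₁ (suc _ , _)) () _

  labelOf-injective : ∀ x y → labelOf x ≡ labelOf y → x ≡ y
  labelOf-injective x y e = shape-coeff-injective x y
    (residue-injective _ _ (proj₁ decoded)) (proj₂ decoded)
    where
    decoded = decode {x} e (residue<81 (shape y))

  sumLabelling : SumLabelling H
  sumLabelling = record
    { label     = labelOf
    ; injective = labelOf-injective
    ; positive  = λ x → ≤-trans (proj₁ (residue-bounds (shape x))) (m≤m+n _ _)
    ; sum-adj   = λ x y _ → adjacent⇒sum x y
    ; adj-sum   = λ x y _ → sum⇒adjacent x y
    }

  hasNTAP : HasNTAP labelOf
  hasNTAP = encode 18 (m + m) , encode 11 m , s≤s z≤n , s≤s z≤n
          , (inj₁ (suc zero , # 3) , refl)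
          , (inj₂ zero , x+d m)
          , (inj₂ (suc zero) , x+2d m)
          , λ (v , e) → residue≢11 (shape v) (proj₁ (decode {v} {c = m} e (s≤s (m≤m+n 11 69))))
    where
    x+d : ∀ n → 29 + (n + (n + n)) * 81 ≡ (18 + (n + n) * 81) + (11 + n * 81)
    x+d = solve-∀
    x+2d : ∀ n → 40 + ((n + n) + (n + n)) * 81 ≡ (18 + (n + n) * 81) + 2 * (11 + n * 81)
    x+2d = solve-∀

lemma6 : (k : ℕ) → 2 ≤ k →
    σ-is (kC4 k) 2 × Σ (SumLabelling (kC4 k +N 2)) (λ L → HasNTAP (label L))
lemma6 (suc (suc m)) (s≤s (s≤s z≤n)) = (sumLabelling , needs-two) , (sumLabelling , hasNTAP)
  where
  open Construction m
  needs-two : ∀ j → j < 2 → ¬ IsSumGraph (kC4 (suc (suc m)) +N j)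
  needs-two j = ¬SumLabelling-+N<2 (kC4 _) (cartesianProduct (allFin _) (allFin 4))
    (λ (i , a) → ∈-cartesianProduct⁺ (∈-allFin i) (∈-allFin a)) (zero , zero) (kC4-two-neighbours _)
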